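{- Let $G$ be any graph of order $n\geq 2$ and let $m$ be an integer with $m>\frac{n(n+1)}{2}$. Then the disjoint union $G\cup mC_3$ is not total prime.
   Context: All graphs are finite and simple. For a graph $G$ with vertex set $V$ and edge set $E$, a total prime labeling is a bijection $\ell: V\cup E\to\{1,2,\ldots,|V|+|E|\}$ such that (i) for every pair of adjacent vertices $u,v$, $\gcd(\ell(u),\ell(v))=1$, and (ii) for every vertex $v$ of degree at least 2, the greatest common divisor of the labels $\ell(uv)$ over all edges $uv$ incident to $v$ equals 1. A graph is total prime if it admits a total prime labeling. $mC_3$ denotes the disjoint union of $m$ copies of the triangle $C_3$, and $G\cup H$ denotes the vertex-disjoint union of graphs $G$ and $H$. -}

module Defs where

open import Data.Nat using (ℕ; zero; suc; _+_; _*_; _<_; _≤_)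
open import Data.Nat.GCD using (gcd)
open import Data.Fin using (Fin; toℕ; _↑ˡ_; _↑ʳ_)
open import Data.Fin as F using ()
open import Data.Product using (_×_; _,_; proj₁; proj₂)
open import Data.Sum using (_⊎_; inj₁; inj₂)
open import Data.List using (List; []; _∷_; _++_; map; length; filter; foldr; allFin)
open import Data.List.Relation.Unary.All using (All)
open import Data.List.Relation.Unary.Unique.Propositional using (Unique)
open import Data.List.Membership.Propositional using (_∈_)
open import Data.List.Relation.Unary.Any using (any?)
open import Data.Fin.Properties using (_≟_)
open import Relation.Nullary using (¬_)
open import Relation.Nullary.Decidable using (_⊎-dec_)
open import Relation.Binary.PropositionalEquality using (_≡_)
open import Function.Bundles using (_⤖_; Bijection)

record Graph : Set where
  constructor mkGraph
  field
    order : ℕ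
    edges : List (Fin order × Fin order)

open Graph public

IsSimple : Graph → Set
IsSimple G = All (λ e → toℕ (proj₁ e) < toℕ (proj₂ e)) (edges G) × Unique (edges G)

size : Graph → ℕ
size G = length (edges G)

Elem : Graph → Set
Elem G = Fin (order G) ⊎ Fin (size G)

edgeAt : (G : Graph) → Fin (size G) → Fin (order G) × Fin (order G)
edgeAt G i = Data.List.lookup (edges G) i

incident : (G : Graph) → Fin (order G) → List (Fin (size G))
incident G v = filter (λ i → (proj₁ (edgeAt G i) ≟ v) ⊎-dec (proj₂ (edgeAt G i) ≟ v)) (allFin (size G))

degree : (G : Graph) → Fin (order G) → ℕ
degree G v = length (incident G v)

-- gcd of a list of naturals (gcd of the empty list is 0)
gcdList : List ℕ → ℕ
gcdList = foldr gcd 0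

-- A total prime labeling: a bijection V ∪ E → {1,…,|V|+|E|}
-- (encoded as a bijection onto Fin (|V|+|E|), label = toℕ + 1).
record TotalPrimeLabeling (G : Graph) : Set where
  field
    bij : Elem G ⤖ Fin (order G + size G)
  label : Elem G → ℕ
  label x = suc (toℕ (Bijection.to bij x))
  field
    adjCoprime : ∀ (i : Fin (size G)) →
      gcd (label (inj₁ (proj₁ (edgeAt G i)))) (label (inj₁ (proj₂ (edgeAt G i)))) ≡ 1
    edgeGcd : ∀ (v : Fin (order G)) → 2 ≤ degree G v →
      gcdList (map (λ i → label (inj₂ i)) (incident G v)) ≡ 1

TotalPrime : Graph → Set
TotalPrime G = TotalPrimeLabeling G

_∪G_ : Graph → Graph → Graph
G ∪G H = mkGraph (order G + order H)
  (map (λ e → proj₁ e ↑ˡ order H , proj₂ e ↑ˡ order H) (edges G) ++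
   map (λ e → order G ↑ʳ proj₁ e , order G ↑ʳ proj₂ e) (edges H))

emptyGraph : Graph
emptyGraph = mkGraph 0 []

C3 : Graph
C3 = mkGraph 3 ((F.zero , F.suc F.zero) ∷ (F.zero , F.suc (F.suc F.zero)) ∷ (F.suc F.zero , F.suc (F.suc F.zero)) ∷ [])

copiesC3 : ℕ → Graph
copiesC3 zero = emptyGraph
copiesC3 (suc m) = C3 ∪G copiesC3 m

-- In a total prime labelling of G ∪ mC₃, with n vertices and e edges in G, exactly
-- ⌊N/2⌋ of the N = n + e + 6m elements receive an even label. Two vertices of a
-- triangle are adjacent, so at most one of them is even; two edges of a triangle are
-- the only edges at their common vertex, whose edge labels must have gcd 1, so at most
-- one of them is even. The even elements therefore fit into n + e + 2m slots (one per
-- element of G, two per triangle), so 2m ≤ n + e + 1 ≤ n(n + 1) + 1, which contradicts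
-- m > n(n + 1)/2 because n(n + 1) is even.

{-# OPTIONS --safe #-}
module Submission where

open import Defs
open import Data.Nat using (ℕ; zero; suc; _+_; _*_; _<_; _≤_; z≤n; s≤s)
open import Data.Nat.Properties
  using (suc-injective; *-suc; +-comm; +-monoˡ-≤; +-monoʳ-≤; *-monoˡ-≤; *-cancelʳ-≡; <⇒≱; ≤-trans; module ≤-Reasoning)
open import Data.Nat.DivMod using (_/_; m*n/n≡m; m/n*n≡m; m/n*n≤m; /-monoˡ-≤)
open import Data.Nat.Divisibility using (_∣_; divides; _∣0; ∣1⇒≡1; ∣m∣n⇒∣m+n; m∣m*n)
open import Data.Nat.GCD using (gcd-greatest)
open import Data.Nat.Tactic.RingSolver using (solve-∀)
open import Data.Fin using (Fin; toℕ; fromℕ<; _↑ˡ_; _↑ʳ_; splitAt; join; combine)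
import Data.Fin as Fin
open import Data.Fin.Patterns using (0F; 1F; 2F)
open import Data.Fin.Properties
  using (toℕ<n; toℕ-injective; toℕ-fromℕ<; ↑ˡ-injective; ↑ʳ-injective; splitAt-↑ˡ; splitAt-↑ʳ; injective⇒≤; combine-injective)
  renaming (_≟_ to _≟ᶠ_; suc-injective to suc-injectiveᶠ)
open import Data.Product using (_×_; _,_; proj₁; proj₂; ∃-syntax)
import Data.Product as Prod
open import Data.Sum using (_⊎_; inj₁; inj₂)
import Data.Sum as Sum
open import Data.Sum.Properties using (inj₁-injective; inj₂-injective)
open import Data.List using (List; []; _∷_; _++_; map; length; lookup; allFin)
open import Data.List.Properties using (length-++; length-map)
open import Data.List.Relation.Unary.All as All using (All; []; _∷_)
open import Data.List.Relation.Unary.All.Properties using (map⁺)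
open import Data.List.Relation.Unary.AllPairs using (_∷_)
open import Data.List.Relation.Unary.Any using (here; there)
open import Data.List.Relation.Unary.Unique.Propositional using (Unique)
open import Data.List.Membership.Propositional using (_∈_)
open import Data.List.Membership.Propositional.Properties using (∈-filter⁺; ∈-filter⁻; ∈-allFin; ∈-lookup)
open import Data.Empty using (⊥-elim)
open import Function using (_∘_)
open import Function.Bundles using (_⤖_; Bijection)
open import Relation.Nullary using (¬_; contradiction)
open import Relation.Nullary.Decidable using (_⊎-dec_)
open import Relation.Binary.PropositionalEquality

2∤1 : ¬ 2 ∣ 1
2∤1 2∣1 = contradiction (∣1⇒≡1 2∣1) λ ()

∣-gcdList : ∀ {d xs} → All (d ∣_) xs → d ∣ gcdList xs
∣-gcdList {d} [] = d ∣0
∣-gcdList (d∣x ∷ d∣xs) = gcd-greatest d∣x (∣-gcdList d∣xs)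

distinct-members⇒2≤length : ∀ {A : Set} {x y : A} {xs} → x ∈ xs → y ∈ xs → x ≢ y → 2 ≤ length xs
distinct-members⇒2≤length (here x≡z) (here y≡z) x≢y = contradiction (trans x≡z (sym y≡z)) x≢y
distinct-members⇒2≤length (here _) (there (here _)) _ = s≤s (s≤s z≤n)
distinct-members⇒2≤length (here _) (there (there _)) _ = s≤s (s≤s z≤n)
distinct-members⇒2≤length (there (here _)) _ _ = s≤s (s≤s z≤n)
distinct-members⇒2≤length (there (there _)) _ _ = s≤s (s≤s z≤n)

lookup-injective : ∀ {A : Set} {xs : List A} → Unique xs → ∀ {i j} → lookup xs i ≡ lookup xs j → i ≡ j
lookup-injective (_ ∷ _) {0F} {0F} _ = refl
lookup-injective (x∉ ∷ _) {0F} {Fin.suc j} eq = contradiction eq (All.lookup x∉ (∈-lookup j))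
lookup-injective (x∉ ∷ _) {Fin.suc i} {0F} eq = contradiction (sym eq) (All.lookup x∉ (∈-lookup i))
lookup-injective (_ ∷ unique) {Fin.suc i} {Fin.suc j} eq = cong Fin.suc (lookup-injective unique eq)

↑ˡ≢↑ʳ : ∀ {m n} (i : Fin m) (j : Fin n) → i ↑ˡ n ≢ m ↑ʳ j
↑ˡ≢↑ʳ 0F j ()
↑ˡ≢↑ʳ (Fin.suc i) j eq = ↑ˡ≢↑ʳ i j (suc-injectiveᶠ eq)

data SplitView (m : ℕ) {n : ℕ} : Fin (m + n) → Set where
  inˡ : (i : Fin m) → SplitView m (i ↑ˡ n)
  inʳ : (j : Fin n) → SplitView m (m ↑ʳ j)

splitView : ∀ m {n} (k : Fin (m + n)) → SplitView m k
splitView zero j = inʳ j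
splitView (suc m) 0F = inˡ 0F
splitView (suc m) (Fin.suc k) with splitView m k
... | inˡ i = inˡ (Fin.suc i)
... | inʳ j = inʳ j

module _ {A B C : Set} (f : A → C) (g : B → C) where

  indexˡ : ∀ xs ys → Fin (length xs) → Fin (length (map f xs ++ map g ys))
  indexˡ (_ ∷ _) _ 0F = 0F
  indexˡ (_ ∷ xs) ys (Fin.suc i) = Fin.suc (indexˡ xs ys i)

  indexʳ : ∀ xs ys → Fin (length ys) → Fin (length (map f xs ++ map g ys))
  indexʳ (_ ∷ xs) ys j = Fin.suc (indexʳ xs ys j)
  indexʳ [] (_ ∷ _) 0F = 0F
  indexʳ [] (_ ∷ ys) (Fin.suc j) = Fin.suc (indexʳ [] ys j)

  splitIndex : ∀ xs ys → Fin (length (map f xs ++ map g ys)) → Fin (length xs) ⊎ Fin (length ys)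
  splitIndex (_ ∷ _) _ 0F = inj₁ 0F
  splitIndex (_ ∷ xs) ys (Fin.suc k) = Sum.map₁ Fin.suc (splitIndex xs ys k)
  splitIndex [] (_ ∷ _) 0F = inj₂ 0F
  splitIndex [] (_ ∷ ys) (Fin.suc k) = Sum.map₂ Fin.suc (splitIndex [] ys k)

  splitIndex-indexˡ : ∀ xs ys i → splitIndex xs ys (indexˡ xs ys i) ≡ inj₁ i
  splitIndex-indexˡ (_ ∷ _) _ 0F = refl
  splitIndex-indexˡ (_ ∷ xs) ys (Fin.suc i) = cong (Sum.map₁ Fin.suc) (splitIndex-indexˡ xs ys i)

  splitIndex-indexʳ : ∀ xs ys j → splitIndex xs ys (indexʳ xs ys j) ≡ inj₂ j
  splitIndex-indexʳ (_ ∷ xs) ys j = cong (Sum.map₁ Fin.suc) (splitIndex-indexʳ xs ys j)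
  splitIndex-indexʳ [] (_ ∷ _) 0F = refl
  splitIndex-indexʳ [] (_ ∷ ys) (Fin.suc j) = cong (Sum.map₂ Fin.suc) (splitIndex-indexʳ [] ys j)

  lookup-indexˡ : ∀ xs ys i → lookup (map f xs ++ map g ys) (indexˡ xs ys i) ≡ f (lookup xs i)
  lookup-indexˡ (_ ∷ _) _ 0F = refl
  lookup-indexˡ (_ ∷ xs) ys (Fin.suc i) = lookup-indexˡ xs ys i

  lookup-indexʳ : ∀ xs ys j → lookup (map f xs ++ map g ys) (indexʳ xs ys j) ≡ g (lookup ys j)
  lookup-indexʳ (_ ∷ xs) ys j = lookup-indexʳ xs ys j
  lookup-indexʳ [] (_ ∷ _) 0F = refl
  lookup-indexʳ [] (_ ∷ ys) (Fin.suc j) = lookup-indexʳ [] ys j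

  data IndexView xs ys : Fin (length (map f xs ++ map g ys)) → Set where
    inˡ : ∀ i → IndexView xs ys (indexˡ xs ys i)
    inʳ : ∀ j → IndexView xs ys (indexʳ xs ys j)

  indexView : ∀ xs ys k → IndexView xs ys k
  indexView (_ ∷ _) _ 0F = inˡ 0F
  indexView (_ ∷ xs) ys (Fin.suc k) with indexView xs ys k
  ... | inˡ i = inˡ (Fin.suc i)
  ... | inʳ j = inʳ j
  indexView [] (_ ∷ _) 0F = inʳ 0F
  indexView [] (_ ∷ ys) (Fin.suc k) with indexView [] ys k
  ... | inʳ j = inʳ (Fin.suc j)

Endpoint : (A : Graph) → Fin (order A) → Fin (size A) → Set
Endpoint A w i = proj₁ (edgeAt A i) ≡ w ⊎ proj₂ (edgeAt A i) ≡ w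

module _ {A : Graph} {w : Fin (order A)} where

  private
    endpoint? = λ (i : Fin (size A)) → (proj₁ (edgeAt A i) ≟ᶠ w) ⊎-dec (proj₂ (edgeAt A i) ≟ᶠ w)

  Endpoint⇒∈incident : ∀ {i} → Endpoint A w i → i ∈ incident A w
  Endpoint⇒∈incident {i} = ∈-filter⁺ endpoint? (∈-allFin i)

  ∈incident⇒Endpoint : ∀ {i} → i ∈ incident A w → Endpoint A w i
  ∈incident⇒Endpoint i∈ = proj₂ (∈-filter⁻ endpoint? {xs = allFin (size A)} i∈)

Adjacent : (A : Graph) → Fin (order A) → Fin (order A) → Set
Adjacent A u v = ∃[ i ] (edgeAt A i ≡ (u , v) ⊎ edgeAt A i ≡ (v , u))

record StarPair (A : Graph) (i j : Fin (size A)) : Set where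
  field
    centre    : Fin (order A)
    distinct  : i ≢ j
    endpointˡ : Endpoint A centre i
    endpointʳ : Endpoint A centre j
    only      : ∀ k → Endpoint A centre k → k ≡ i ⊎ k ≡ j

StarPair-sym : ∀ {A i j} → StarPair A i j → StarPair A j i
StarPair-sym s = record
  { centre = centre ; distinct = distinct ∘ sym ; endpointˡ = endpointʳ ; endpointʳ = endpointˡ
  ; only = λ k → Sum.swap ∘ only k }
  where open StarPair s

module _ {A : Graph} (L : TotalPrimeLabeling A) where
  open TotalPrimeLabeling L

  adjacent-not-both-even : ∀ {u v} → Adjacent A u v → 2 ∣ label (inj₁ u) → ¬ 2 ∣ label (inj₁ v)
  adjacent-not-both-even (i , inj₁ refl) 2∣u 2∣v = 2∤1 (subst (2 ∣_) (adjCoprime i) (gcd-greatest 2∣u 2∣v))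
  adjacent-not-both-even (i , inj₂ refl) 2∣u 2∣v = 2∤1 (subst (2 ∣_) (adjCoprime i) (gcd-greatest 2∣v 2∣u))

  starPair-not-both-even : ∀ {i j} → StarPair A i j → 2 ∣ label (inj₂ i) → ¬ 2 ∣ label (inj₂ j)
  starPair-not-both-even {i} {j} s 2∣i 2∣j =
    2∤1 (subst (2 ∣_) (edgeGcd centre 2≤degree) (∣-gcdList (map⁺ (All.tabulate even-at-centre))))
    where
    open StarPair s
    2≤degree : 2 ≤ degree A centre
    2≤degree = distinct-members⇒2≤length (Endpoint⇒∈incident {A} endpointˡ) (Endpoint⇒∈incident {A} endpointʳ) distinct
    even-at-centre : ∀ {k} → k ∈ incident A centre → 2 ∣ label (inj₂ k)
    even-at-centre {k} k∈ with only k (∈incident⇒Endpoint {A} k∈)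
    ... | inj₁ refl = 2∣i
    ... | inj₂ refl = 2∣j

module _ {X : Set} {N : ℕ} (b : X ⤖ Fin N) where
  open Bijection b using (to; strictlySurjective)

  evenInjective⇒half≤ : ∀ {K} (s : X → Fin K) →
    (∀ {x y} → 2 ∣ suc (toℕ (to x)) → 2 ∣ suc (toℕ (to y)) → s x ≡ s y → x ≡ y) → N / 2 ≤ K
  evenInjective⇒half≤ s s-injective = injective⇒≤ {f = s ∘ evenAt} evenAt-injective
    where
    odd<N : (t : Fin (N / 2)) → suc (toℕ t * 2) < N
    odd<N t = ≤-trans (*-monoˡ-≤ 2 (toℕ<n t)) (m/n*n≤m N 2)
    evenAt : Fin (N / 2) → X
    evenAt t = proj₁ (strictlySurjective (fromℕ< (odd<N t)))
    to-evenAt : ∀ t → toℕ (to (evenAt t)) ≡ suc (toℕ t * 2)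
    to-evenAt t = trans (cong toℕ (proj₂ (strictlySurjective (fromℕ< (odd<N t))))) (toℕ-fromℕ< (odd<N t))
    evenAt-even : ∀ t → 2 ∣ suc (toℕ (to (evenAt t)))
    evenAt-even t = divides (suc (toℕ t)) (cong suc (to-evenAt t))
    evenAt-injective : ∀ {t t′} → s (evenAt t) ≡ s (evenAt t′) → t ≡ t′
    evenAt-injective {t} {t′} eq = toℕ-injective (*-cancelʳ-≡ _ _ 2 (suc-injective (begin
      suc (toℕ t * 2)        ≡⟨ to-evenAt t ⟨
      toℕ (to (evenAt t))    ≡⟨ cong (toℕ ∘ to) (s-injective (evenAt-even t) (evenAt-even t′) eq) ⟩
      toℕ (to (evenAt t′))   ≡⟨ to-evenAt t′ ⟩
      suc (toℕ t′ * 2)       ∎)))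
      where open ≡-Reasoning

SeparatesVertices : (A : Graph) {a : ℕ} → (Fin (order A) → Fin a) → Set
SeparatesVertices A s = ∀ u v → s u ≡ s v → u ≡ v ⊎ Adjacent A u v

SeparatesEdges : (A : Graph) {b : ℕ} → (Fin (size A) → Fin b) → Set
SeparatesEdges A s = ∀ i j → s i ≡ s j → i ≡ j ⊎ StarPair A i j

separatingSlots⇒half≤ : ∀ {A a b} {sV : Fin (order A) → Fin a} {sE : Fin (size A) → Fin b} →
  SeparatesVertices A sV → SeparatesEdges A sE → TotalPrimeLabeling A → (order A + size A) / 2 ≤ a + b
separatingSlots⇒half≤ {A} {a} {b} {sV} {sE} sepV sepE L =
  evenInjective⇒half≤ bij slot evens-injective
  where
  open TotalPrimeLabeling L
  slot : Elem A → Fin (a + b)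
  slot = join a b ∘ Sum.map sV sE
  evens-injective : ∀ {x y} → 2 ∣ label x → 2 ∣ label y → slot x ≡ slot y → x ≡ y
  evens-injective {inj₁ u} {inj₁ v} 2∣u 2∣v eq with sepV u v (↑ˡ-injective b _ _ eq)
  ... | inj₁ refl = refl
  ... | inj₂ adjacent = contradiction 2∣v (adjacent-not-both-even L adjacent 2∣u)
  evens-injective {inj₂ i} {inj₂ j} 2∣i 2∣j eq with sepE i j (↑ʳ-injective a _ _ eq)
  ... | inj₁ refl = refl
  ... | inj₂ star = contradiction 2∣j (starPair-not-both-even L star 2∣i)
  evens-injective {inj₁ u} {inj₂ j} _ _ eq = contradiction eq (↑ˡ≢↑ʳ (sV u) (sE j))
  evens-injective {inj₂ i} {inj₁ v} _ _ eq = contradiction (sym eq) (↑ˡ≢↑ʳ (sV v) (sE i))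

record ComponentEmbedding (A B : Graph) : Set where
  field
    vertex            : Fin (order A) → Fin (order B)
    edge              : Fin (size A) → Fin (size B)
    vertex-injective  : ∀ {u v} → vertex u ≡ vertex v → u ≡ v
    edge-injective    : ∀ {i j} → edge i ≡ edge j → i ≡ j
    edgeAt-edge       : ∀ i → edgeAt B (edge i) ≡ Prod.map vertex vertex (edgeAt A i)
    incident-in-image : ∀ {w k} → Endpoint B (vertex w) k → ∃[ i ] edge i ≡ k

  Endpoint-edge⁺ : ∀ {w i} → Endpoint A w i → Endpoint B (vertex w) (edge i)
  Endpoint-edge⁺ {i = i} = Sum.map (trans (cong proj₁ (edgeAt-edge i)) ∘ cong vertex)
                                   (trans (cong proj₂ (edgeAt-edge i)) ∘ cong vertex)

  Endpoint-edge⁻ : ∀ {w i} → Endpoint B (vertex w) (edge i) → Endpoint A w i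
  Endpoint-edge⁻ {i = i} = Sum.map (vertex-injective ∘ trans (sym (cong proj₁ (edgeAt-edge i))))
                                   (vertex-injective ∘ trans (sym (cong proj₂ (edgeAt-edge i))))

  Adjacent-map : ∀ {u v} → Adjacent A u v → Adjacent B (vertex u) (vertex v)
  Adjacent-map (i , ends) = edge i , Sum.map mapEnds mapEnds ends
    where
    mapEnds : ∀ {e} → edgeAt A i ≡ e → edgeAt B (edge i) ≡ Prod.map vertex vertex e
    mapEnds = trans (edgeAt-edge i) ∘ cong (Prod.map vertex vertex)

  StarPair-map : ∀ {i j} → StarPair A i j → StarPair B (edge i) (edge j)
  StarPair-map {i} {j} s = record
    { centre = vertex centre ; distinct = distinct ∘ edge-injective
    ; endpointˡ = Endpoint-edge⁺ endpointˡ ; endpointʳ = Endpoint-edge⁺ endpointʳ ; only = only′ }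
    where
    open StarPair s
    only′ : ∀ k → Endpoint B (vertex centre) k → k ≡ edge i ⊎ k ≡ edge j
    only′ k at with incident-in-image at
    ... | i′ , refl = Sum.map (cong edge) (cong edge) (only i′ (Endpoint-edge⁻ at))

open ComponentEmbedding using (Adjacent-map; StarPair-map)

module _ (A B : Graph) where

  private
    liftˡ : Fin (order A) × Fin (order A) → Fin (order (A ∪G B)) × Fin (order (A ∪G B))
    liftˡ = Prod.map (_↑ˡ order B) (_↑ˡ order B)
    liftʳ : Fin (order B) × Fin (order B) → Fin (order (A ∪G B)) × Fin (order (A ∪G B))
    liftʳ = Prod.map (order A ↑ʳ_) (order A ↑ʳ_)

  edgeˡ : Fin (size A) → Fin (size (A ∪G B))
  edgeˡ = indexˡ liftˡ liftʳ (edges A) (edges B)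

  edgeʳ : Fin (size B) → Fin (size (A ∪G B))
  edgeʳ = indexʳ liftˡ liftʳ (edges A) (edges B)

  splitEdge : Fin (size (A ∪G B)) → Fin (size A) ⊎ Fin (size B)
  splitEdge = splitIndex liftˡ liftʳ (edges A) (edges B)

  splitEdge-edgeˡ : ∀ i → splitEdge (edgeˡ i) ≡ inj₁ i
  splitEdge-edgeˡ = splitIndex-indexˡ liftˡ liftʳ (edges A) (edges B)

  splitEdge-edgeʳ : ∀ j → splitEdge (edgeʳ j) ≡ inj₂ j
  splitEdge-edgeʳ = splitIndex-indexʳ liftˡ liftʳ (edges A) (edges B)

  size-∪G : size (A ∪G B) ≡ size A + size B
  size-∪G = trans (length-++ (map liftˡ (edges A)))
                  (cong₂ _+_ (length-map liftˡ (edges A)) (length-map liftʳ (edges B)))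

  ∪G-embedˡ : ComponentEmbedding A (A ∪G B)
  ∪G-embedˡ = record
    { vertex = _↑ˡ order B
    ; edge = edgeˡ
    ; vertex-injective = ↑ˡ-injective (order B) _ _
    ; edge-injective = λ {i} {j} eq →
        inj₁-injective (trans (sym (splitEdge-edgeˡ i)) (trans (cong splitEdge eq) (splitEdge-edgeˡ j)))
    ; edgeAt-edge = lookup-indexˡ liftˡ liftʳ (edges A) (edges B)
    ; incident-in-image = closed
    }
    where
    closed : ∀ {w k} → Endpoint (A ∪G B) (w ↑ˡ order B) k → ∃[ i ] edgeˡ i ≡ k
    closed {w} {k} at with indexView liftˡ liftʳ (edges A) (edges B) k
    ... | inˡ i = i , refl
    ... | inʳ j = ⊥-elim (Sum.[ (λ e → ↑ˡ≢↑ʳ w _ (trans (sym e) (cong proj₁ ends)))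
                              , (λ e → ↑ˡ≢↑ʳ w _ (trans (sym e) (cong proj₂ ends))) ] at)
      where
      ends : edgeAt (A ∪G B) (edgeʳ j) ≡ liftʳ (edgeAt B j)
      ends = lookup-indexʳ liftˡ liftʳ (edges A) (edges B) j

  ∪G-embedʳ : ComponentEmbedding B (A ∪G B)
  ∪G-embedʳ = record
    { vertex = order A ↑ʳ_
    ; edge = edgeʳ
    ; vertex-injective = ↑ʳ-injective (order A) _ _
    ; edge-injective = λ {i} {j} eq →
        inj₂-injective (trans (sym (splitEdge-edgeʳ i)) (trans (cong splitEdge eq) (splitEdge-edgeʳ j)))
    ; edgeAt-edge = lookup-indexʳ liftˡ liftʳ (edges A) (edges B)
    ; incident-in-image = closed
    }
    where
    closed : ∀ {w k} → Endpoint (A ∪G B) (order A ↑ʳ w) k → ∃[ j ] edgeʳ j ≡ k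
    closed {w} {k} at with indexView liftˡ liftʳ (edges A) (edges B) k
    ... | inʳ j = j , refl
    ... | inˡ i = ⊥-elim (Sum.[ (λ e → ↑ˡ≢↑ʳ _ w (trans (sym (cong proj₁ ends)) e))
                              , (λ e → ↑ˡ≢↑ʳ _ w (trans (sym (cong proj₂ ends)) e)) ] at)
      where
      ends : edgeAt (A ∪G B) (edgeˡ i) ≡ liftˡ (edgeAt A i)
      ends = lookup-indexˡ liftˡ liftʳ (edges A) (edges B) i

  module _ {a b : ℕ} where

    ∪G-vertexSlot : (Fin (order A) → Fin a) → (Fin (order B) → Fin b) → Fin (order (A ∪G B)) → Fin (a + b)
    ∪G-vertexSlot sA sB = join a b ∘ Sum.map sA sB ∘ splitAt (order A)

    ∪G-edgeSlot : (Fin (size A) → Fin a) → (Fin (size B) → Fin b) → Fin (size (A ∪G B)) → Fin (a + b)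
    ∪G-edgeSlot sA sB = join a b ∘ Sum.map sA sB ∘ splitEdge

    ∪G-separatesVertices : ∀ {sA sB} → SeparatesVertices A sA → SeparatesVertices B sB →
                           SeparatesVertices (A ∪G B) (∪G-vertexSlot sA sB)
    ∪G-separatesVertices {sA} {sB} sepA sepB u v eq with splitView (order A) u | splitView (order A) v
    ... | inˡ u′ | inˡ v′ rewrite splitAt-↑ˡ (order A) u′ (order B) | splitAt-↑ˡ (order A) v′ (order B) =
      Sum.map (cong (_↑ˡ order B)) (Adjacent-map ∪G-embedˡ) (sepA u′ v′ (↑ˡ-injective b _ _ eq))
    ... | inʳ u′ | inʳ v′ rewrite splitAt-↑ʳ (order A) (order B) u′ | splitAt-↑ʳ (order A) (order B) v′ =
      Sum.map (cong (order A ↑ʳ_)) (Adjacent-map ∪G-embedʳ) (sepB u′ v′ (↑ʳ-injective a _ _ eq))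
    ... | inˡ u′ | inʳ v′ rewrite splitAt-↑ˡ (order A) u′ (order B) | splitAt-↑ʳ (order A) (order B) v′ =
      contradiction eq (↑ˡ≢↑ʳ _ _)
    ... | inʳ u′ | inˡ v′ rewrite splitAt-↑ʳ (order A) (order B) u′ | splitAt-↑ˡ (order A) v′ (order B) =
      contradiction (sym eq) (↑ˡ≢↑ʳ _ _)

    ∪G-separatesEdges : ∀ {sA sB} → SeparatesEdges A sA → SeparatesEdges B sB →
                        SeparatesEdges (A ∪G B) (∪G-edgeSlot sA sB)
    ∪G-separatesEdges {sA} {sB} sepA sepB i j eq
      with indexView liftˡ liftʳ (edges A) (edges B) i | indexView liftˡ liftʳ (edges A) (edges B) j
    ... | inˡ i′ | inˡ j′ rewrite splitEdge-edgeˡ i′ | splitEdge-edgeˡ j′ =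
      Sum.map (cong edgeˡ) (StarPair-map ∪G-embedˡ) (sepA i′ j′ (↑ˡ-injective b _ _ eq))
    ... | inʳ i′ | inʳ j′ rewrite splitEdge-edgeʳ i′ | splitEdge-edgeʳ j′ =
      Sum.map (cong edgeʳ) (StarPair-map ∪G-embedʳ) (sepB i′ j′ (↑ʳ-injective a _ _ eq))
    ... | inˡ i′ | inʳ j′ rewrite splitEdge-edgeˡ i′ | splitEdge-edgeʳ j′ = contradiction eq (↑ˡ≢↑ʳ _ _)
    ... | inʳ i′ | inˡ j′ rewrite splitEdge-edgeʳ i′ | splitEdge-edgeˡ j′ = contradiction (sym eq) (↑ˡ≢↑ʳ _ _)

C3-adjacent : ∀ u v → u ≡ v ⊎ Adjacent C3 u v
C3-adjacent 0F 0F = inj₁ refl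
C3-adjacent 0F 1F = inj₂ (0F , inj₁ refl)
C3-adjacent 0F 2F = inj₂ (1F , inj₁ refl)
C3-adjacent 1F 0F = inj₂ (0F , inj₂ refl)
C3-adjacent 1F 1F = inj₁ refl
C3-adjacent 1F 2F = inj₂ (2F , inj₁ refl)
C3-adjacent 2F 0F = inj₂ (1F , inj₂ refl)
C3-adjacent 2F 1F = inj₂ (2F , inj₂ refl)
C3-adjacent 2F 2F = inj₁ refl

C3-starPair : ∀ i j → i ≡ j ⊎ StarPair C3 i j
C3-starPair 0F 0F = inj₁ refl
C3-starPair 0F 1F = inj₂ record
  { centre = 0F ; distinct = λ () ; endpointˡ = inj₁ refl ; endpointʳ = inj₁ refl
  ; only = λ { 0F _ → inj₁ refl ; 1F _ → inj₂ refl ; 2F (inj₁ ()) ; 2F (inj₂ ()) } }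
C3-starPair 0F 2F = inj₂ record
  { centre = 1F ; distinct = λ () ; endpointˡ = inj₂ refl ; endpointʳ = inj₁ refl
  ; only = λ { 0F _ → inj₁ refl ; 1F (inj₁ ()) ; 1F (inj₂ ()) ; 2F _ → inj₂ refl } }
C3-starPair 1F 2F = inj₂ record
  { centre = 2F ; distinct = λ () ; endpointˡ = inj₂ refl ; endpointʳ = inj₂ refl
  ; only = λ { 0F (inj₁ ()) ; 0F (inj₂ ()) ; 1F _ → inj₁ refl ; 2F _ → inj₂ refl } }
C3-starPair 1F 0F = Sum.map sym StarPair-sym (C3-starPair 0F 1F)
C3-starPair 1F 1F = inj₁ refl
C3-starPair 2F 0F = Sum.map sym StarPair-sym (C3-starPair 0F 2F)
C3-starPair 2F 1F = Sum.map sym StarPair-sym (C3-starPair 1F 2F)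
C3-starPair 2F 2F = inj₁ refl

triangleOfVertex : ∀ m → Fin (order (copiesC3 m)) → Fin m
triangleOfVertex zero ()
triangleOfVertex (suc m) = ∪G-vertexSlot C3 (copiesC3 m) (λ _ → 0F) (triangleOfVertex m)

triangleOfEdge : ∀ m → Fin (size (copiesC3 m)) → Fin m
triangleOfEdge zero ()
triangleOfEdge (suc m) = ∪G-edgeSlot C3 (copiesC3 m) (λ _ → 0F) (triangleOfEdge m)

copiesC3-separatesVertices : ∀ m → SeparatesVertices (copiesC3 m) (triangleOfVertex m)
copiesC3-separatesVertices zero ()
copiesC3-separatesVertices (suc m) =
  ∪G-separatesVertices C3 (copiesC3 m) (λ u v _ → C3-adjacent u v) (copiesC3-separatesVertices m)

copiesC3-separatesEdges : ∀ m → SeparatesEdges (copiesC3 m) (triangleOfEdge m)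
copiesC3-separatesEdges zero ()
copiesC3-separatesEdges (suc m) =
  ∪G-separatesEdges C3 (copiesC3 m) (λ i j _ → C3-starPair i j) (copiesC3-separatesEdges m)

order-copiesC3 : ∀ m → order (copiesC3 m) ≡ m * 3
order-copiesC3 zero = refl
order-copiesC3 (suc m) = cong (3 +_) (order-copiesC3 m)

size-copiesC3 : ∀ m → size (copiesC3 m) ≡ m * 3
size-copiesC3 zero = refl
size-copiesC3 (suc m) = trans (size-∪G C3 (copiesC3 m)) (cong (3 +_) (size-copiesC3 m))

size≤order*order : ∀ {A} → Unique (edges A) → size A ≤ order A * order A
size≤order*order {A} unique = injective⇒≤ {f = λ i → combine (proj₁ (edgeAt A i)) (proj₂ (edgeAt A i))}
  (λ eq → lookup-injective unique (Prod.uncurry (cong₂ _,_) (combine-injective _ _ _ _ eq)))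

2∣n*[1+n] : ∀ n → 2 ∣ n * suc n
2∣n*[1+n] zero = 2 ∣0
2∣n*[1+n] (suc n) = subst (2 ∣_) (recurrence n) (∣m∣n⇒∣m+n (2∣n*[1+n] n) (m∣m*n (suc n)))
  where
  recurrence : ∀ n → n * suc n + 2 * suc n ≡ suc n * suc (suc n)
  recurrence = solve-∀

slots<half : ∀ n e m → e ≤ n * n → n * suc n / 2 < m →
             (n + m) + (e + m) < ((n + m * 3) + (e + m * 3)) / 2
slots<half n e m e≤n*n n[n+1]/2<m = begin
  suc ((n + m) + (e + m))                ≡⟨ m*n/n≡m _ 2 ⟨
  suc ((n + m) + (e + m)) * 2 / 2        ≤⟨ /-monoˡ-≤ 2 double≤ ⟩
  ((n + m * 3) + (e + m * 3)) / 2        ∎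
  where
  open ≤-Reasoning
  n+e+2≤m*2 : n + e + 2 ≤ m * 2
  n+e+2≤m*2 = begin
    n + e + 2                 ≤⟨ +-monoˡ-≤ 2 (+-monoʳ-≤ n e≤n*n) ⟩
    n + n * n + 2             ≡⟨ cong (_+ 2) (*-suc n n) ⟨
    n * suc n + 2             ≡⟨ cong (_+ 2) (m/n*n≡m (2∣n*[1+n] n)) ⟨
    n * suc n / 2 * 2 + 2     ≡⟨ +-comm _ 2 ⟩
    suc (n * suc n / 2) * 2   ≤⟨ *-monoˡ-≤ 2 n[n+1]/2<m ⟩
    m * 2                     ∎
  double≤ : suc ((n + m) + (e + m)) * 2 ≤ (n + m * 3) + (e + m * 3)
  double≤ = begin
    suc ((n + m) + (e + m)) * 2       ≡⟨ lhs n e m ⟩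
    (n + e + 2) + (n + e + m * 4)     ≤⟨ +-monoˡ-≤ (n + e + m * 4) n+e+2≤m*2 ⟩
    m * 2 + (n + e + m * 4)           ≡⟨ rhs n e m ⟩
    (n + m * 3) + (e + m * 3)         ∎
    where
    lhs : ∀ n e m → suc ((n + m) + (e + m)) * 2 ≡ (n + e + 2) + (n + e + m * 4)
    lhs = solve-∀
    rhs : ∀ n e m → m * 2 + (n + e + m * 4) ≡ (n + m * 3) + (e + m * 3)
    rhs = solve-∀

mainTheorem18 : (G : Graph) → IsSimple G → 2 ≤ order G → (m : ℕ) →
    order G * suc (order G) / 2 < m → ¬ TotalPrime (G ∪G copiesC3 m)
mainTheorem18 G (_ , unique) _ m n[n+1]/2<m L =
  <⇒≱ (slots<half (order G) (size G) m (size≤order*order unique) n[n+1]/2<m) half≤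
  where
  T = copiesC3 m
  order+size≡ : order (G ∪G T) + size (G ∪G T) ≡ (order G + m * 3) + (size G + m * 3)
  order+size≡ = cong₂ _+_ (cong (order G +_) (order-copiesC3 m)) (trans (size-∪G G T) (cong (size G +_) (size-copiesC3 m)))
  half≤ : ((order G + m * 3) + (size G + m * 3)) / 2 ≤ (order G + m) + (size G + m)
  half≤ = subst (λ N → N / 2 ≤ (order G + m) + (size G + m)) order+size≡ (separatingSlots⇒half≤
    (∪G-separatesVertices G T {sA = λ u → u} (λ _ _ → inj₁) (copiesC3-separatesVertices m))
    (∪G-separatesEdges G T {sA = λ i → i} (λ _ _ → inj₁) (copiesC3-separatesEdges m))
    L)
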